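{- Let $n\geq 10$ be even. Then there exists an $\mathrm{SH}^*(n;10)$.
   Context: An $\mathrm{H}(n;k)$ is an $n\times n$ partially filled array with entries in $\{\pm1,\dots,\pm nk\}\subset\mathbb{Z}$ such that no two entries agree in absolute value, each row and each column has exactly $k$ filled cells, and every row and every column sums to $0$ in $\mathbb{Z}$. An ordering $(a_1,\dots,a_k)$ is simple modulo $v$ if its partial sums $s_i=\sum_{j\le i}a_j$ are pairwise distinct modulo $v$. An $\mathrm{SH}^*(n;k)$ is an $\mathrm{H}(n;k)$ in which the natural ordering of each row (left to right, skipping empty cells) and each column (top to bottom, skipping empty cells) is simple both modulo $2nk+1$ and modulo $2nk+2$. -}

module Defs where

open import Data.Nat using (ℕ; suc; _*_; _+_; NonZero)
open import Data.Integer as ℤ using (ℤ; ∣_∣; 0ℤ)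
open import Data.Integer.DivMod using (_%ℕ_)
open import Data.Fin using (Fin)
open import Data.List using (List; []; _∷_; mapMaybe; length; map; foldr; allFin)
open import Data.List.Relation.Unary.Unique.Propositional using (Unique)
open import Data.Maybe using (Maybe; just; nothing)
open import Data.Product using (_×_)
open import Relation.Binary.PropositionalEquality using (_≡_; _≢_)

sumℤ : List ℤ → ℤ
sumℤ = foldr ℤ._+_ 0ℤ

-- A partially filled n×n array: cell (i , j) is either empty (nothing)
-- or filled with an integer (just x).  i = row index, j = column index.
Array : ℕ → Set
Array n = Fin n → Fin n → Maybe ℤ

row : ∀ {n} → Array n → Fin n → List ℤ
row {n} A i = mapMaybe (λ j → A i j) (allFin n)

col : ∀ {n} → Array n → Fin n → List ℤ
col {n} A j = mapMaybe (λ i → A i j) (allFin n)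

entries : ∀ {n} → Array n → List ℤ
entries {n} A = mapMaybe (λ p → A (Data.Product.proj₁ p) (Data.Product.proj₂ p))
                  (Data.List.cartesianProduct (allFin n) (allFin n))

partialSums : List ℤ → List ℤ
partialSums = go 0ℤ
  where
  go : ℤ → List ℤ → List ℤ
  go acc []       = []
  go acc (x ∷ xs) = (acc ℤ.+ x) ∷ go (acc ℤ.+ x) xs

SimpleMod : (v : ℕ) → .{{NonZero v}} → List ℤ → Set
SimpleMod v xs = Unique (map (λ s → s %ℕ v) (partialSums xs))

record IsH (n k : ℕ) (A : Array n) : Set where
  field
    entry-range : ∀ i j x → A i j ≡ just x → (x ≢ 0ℤ) × (∣ x ∣ Data.Nat.≤ n * k)
    abs-distinct : Unique (map ∣_∣ (entries A))
    row-size : ∀ i → length (row A i) ≡ k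
    col-size : ∀ j → length (col A j) ≡ k
    row-sum : ∀ i → sumℤ (row A i) ≡ 0ℤ
    col-sum : ∀ j → sumℤ (col A j) ≡ 0ℤ

record IsSHStar (n k : ℕ) (A : Array n) : Set where
  field
    isH : IsH n k A
    row-simple₁ : ∀ i → SimpleMod (suc (2 * n * k)) (row A i)
    row-simple₂ : ∀ i → SimpleMod (suc (suc (2 * n * k))) (row A i)
    col-simple₁ : ∀ j → SimpleMod (suc (2 * n * k)) (col A j)
    col-simple₂ : ∀ j → SimpleMod (suc (suc (2 * n * k))) (col A j)

module Submission where

-- Write n = 2m.  The array is made of m × m blocks of size 2 × 2; block (I , J) is filled exactly
-- when δ = J − I mod m is less than 5, and its (r , c) entry is then ±(B δ r c + 20 I) for a fixed
-- arrangement B of 1, …, 20.  Every row and every column meets five blocks, in one of finitely many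
-- cyclic orders, and reads as five pairs ±(p + 20 a), ∓(q + 20 a), whose sums do not depend on the
-- level a < m of the block.  Hence every partial sum of a line is k + ε · 20 a with a key
-- (k , ε ∈ {1, −1, 0}) that does not depend on the levels, and two partial sums differ by at most
-- 40 m < 2nk + 1; so they are distinct modulo 2nk + 1 and 2nk + 2 once they are distinct in ℤ.
-- This is decided once for the finitely many key sequences: each difference of keys is either not
-- a multiple of 20 or has a sign that 20 (ε a − ε′ a′) cannot have.

module Lines where

  open import Data.Bool using (Bool; true; false; not)
  open import Data.Integer as ℤ using (ℤ; +_; -[1+_]; 0ℤ; 1ℤ; -1ℤ; ∣_∣; _+_; _-_; -_; _*_)
  open import Data.Integer.DivMod using (_%ℕ_; _/ℕ_; a≡a%ℕn+[a/ℕn]*n)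
  open import Data.Integer.Divisibility.Signed using (_∣_; _∣?_; divides)
  import Data.Integer.Properties as ℤ
  open import Data.Integer.Tactic.RingSolver using (solve-∀)
  open import Data.List using (List; []; _∷_; drop; map; length; concatMap)
  open import Data.List.Relation.Unary.All using (All; []; _∷_)
  import Data.List.Relation.Unary.All as All
  open import Data.List.Relation.Unary.AllPairs using (AllPairs; []; _∷_; allPairs?)
  import Data.List.Relation.Unary.AllPairs.Properties as AllPairs
  open import Data.Nat as ℕ using (ℕ; suc; NonZero; z≤n)
  import Data.Nat.Properties as ℕ
  import Data.Nat.Tactic.RingSolver as ℕ-Solver
  open import Data.Product using (_×_; _,_; proj₁; proj₂)
  open import Data.Sum using (_⊎_; inj₁; inj₂)
  open import Function using (_∘_)
  open import Relation.Nullary using (¬_; Dec)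
  open import Relation.Nullary.Decidable using (_×-dec_; _⊎-dec_; ¬?)
  open import Relation.Binary.PropositionalEquality

  open import Defs

  congruent∧close⇒≡ : ∀ x y V .{{_ : NonZero V}} → x %ℕ V ≡ y %ℕ V → ∣ x - y ∣ ℕ.< V → x ≡ y
  congruent∧close⇒≡ x y V x≡y ∣x-y∣<V = ℤ.i-j≡0⇒i≡j x y (begin
    x - y     ≡⟨ x-y≡q*V ⟩
    q * + V   ≡⟨ cong (_* + V) (ℤ.∣i∣≡0⇒i≡0 {q} ∣q∣≡0) ⟩
    0ℤ        ∎)
    where
    open ≡-Reasoning
    q : ℤ
    q = x /ℕ V - y /ℕ V
    cancel : ∀ (r a b v : ℤ) → (r + a * v) - (r + b * v) ≡ (a - b) * v
    cancel = solve-∀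
    x-y≡q*V : x - y ≡ q * + V
    x-y≡q*V = begin
      x - y
        ≡⟨ cong₂ _-_ (a≡a%ℕn+[a/ℕn]*n x V) (a≡a%ℕn+[a/ℕn]*n y V) ⟩
      (+ (x %ℕ V) + x /ℕ V * + V) - (+ (y %ℕ V) + y /ℕ V * + V)
        ≡⟨ cong (λ r → (+ (x %ℕ V) + x /ℕ V * + V) - (+ r + y /ℕ V * + V)) (sym x≡y) ⟩
      (+ (x %ℕ V) + x /ℕ V * + V) - (+ (x %ℕ V) + y /ℕ V * + V)
        ≡⟨ cancel (+ (x %ℕ V)) (x /ℕ V) (y /ℕ V) (+ V) ⟩
      q * + V ∎
    ∣q∣*V<1*V : ∣ q ∣ ℕ.* V ℕ.< 1 ℕ.* V
    ∣q∣*V<1*V = subst₂ ℕ._<_ (trans (cong ∣_∣ x-y≡q*V) (ℤ.abs-* q (+ V))) (sym (ℕ.*-identityˡ V)) ∣x-y∣<V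
    ∣q∣≡0 : ∣ q ∣ ≡ 0
    ∣q∣≡0 = ℕ.n<1⇒n≡0 (ℕ.*-cancelʳ-< V ∣ q ∣ 1 ∣q∣*V<1*V)

  partialSumsFrom : ℤ → List ℤ → List ℤ
  partialSumsFrom acc []       = []
  partialSumsFrom acc (x ∷ xs) = (acc + x) ∷ partialSumsFrom (acc + x) xs

  -- Defs builds partialSums from a where-bound helper that cannot be named here; matching on the
  -- value of the accumulator makes the helper's `0ℤ + w` reduce to `w`, so the induction applies.
  partialSums-tail : ∀ w xs → drop 1 (partialSums (w ∷ xs)) ≡ partialSumsFrom (0ℤ + w) xs
  partialSums-tail w []       = refl
  partialSums-tail w (x ∷ xs) with (0ℤ + w) + x
  ... | + n      = cong (+ n ∷_) (partialSums-tail (+ n) xs)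
  ... | -[1+ n ] = cong (-[1+ n ] ∷_) (partialSums-tail -[1+ n ] xs)

  partialSums≡partialSumsFrom0 : ∀ xs → partialSums xs ≡ partialSumsFrom 0ℤ xs
  partialSums≡partialSumsFrom0 []       = refl
  partialSums≡partialSumsFrom0 (x ∷ xs) = cong (0ℤ + x ∷_) (partialSums-tail x xs)

  allPairs-mapWith-All : ∀ {A : Set} {P : A → Set} {R S : A → A → Set} →
                         (∀ {x y} → P x → P y → R x y → S x y) →
                         ∀ {xs} → All P xs → AllPairs R xs → AllPairs S xs
  allPairs-mapWith-All f []         []         = []
  allPairs-mapWith-All f (px ∷ pxs) (rx ∷ rxs) =
    All.zipWith (λ (py , r) → f px py r) (pxs , rx) ∷ allPairs-mapWith-All f pxs rxs

  data Slope : Set where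
    up down flat : Slope

  ⟦_⟧ : Slope → ℤ
  ⟦ up ⟧   = 1ℤ
  ⟦ down ⟧ = -1ℤ
  ⟦ flat ⟧ = 0ℤ

  ∣⟦_⟧∣≤1 : ∀ s → ∣ ⟦ s ⟧ ∣ ℕ.≤ 1
  ∣⟦ up ⟧∣≤1   = ℕ.≤-refl
  ∣⟦ down ⟧∣≤1 = ℕ.≤-refl
  ∣⟦ flat ⟧∣≤1 = z≤n

  -- A partial sum of a line is recorded by its key (k , s) and the level a of its block; its value
  -- is k + ⟦ s ⟧ · N · a (Stride.value).
  Key : Set
  Key = ℤ × Slope

  Form : Set
  Form = Key × ℕ

  drift : Slope → Slope → ℕ → ℕ → ℤ
  drift s t a b = ⟦ s ⟧ * + a - ⟦ t ⟧ * + b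

  ∣drift∣≤ : ∀ s t a b → ∣ drift s t a b ∣ ℕ.≤ a ℕ.+ b
  ∣drift∣≤ s t a b = begin
    ∣ ⟦ s ⟧ * + a - ⟦ t ⟧ * + b ∣
      ≤⟨ ℤ.∣i-j∣≤∣i∣+∣j∣ (⟦ s ⟧ * + a) (⟦ t ⟧ * + b) ⟩
    ∣ ⟦ s ⟧ * + a ∣ ℕ.+ ∣ ⟦ t ⟧ * + b ∣
      ≡⟨ cong₂ ℕ._+_ (ℤ.abs-* ⟦ s ⟧ (+ a)) (ℤ.abs-* ⟦ t ⟧ (+ b)) ⟩
    ∣ ⟦ s ⟧ ∣ ℕ.* a ℕ.+ ∣ ⟦ t ⟧ ∣ ℕ.* b
      ≤⟨ ℕ.+-mono-≤ (ℕ.*-monoˡ-≤ a ∣⟦ s ⟧∣≤1) (ℕ.*-monoˡ-≤ b ∣⟦ t ⟧∣≤1) ⟩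
    1 ℕ.* a ℕ.+ 1 ℕ.* b
      ≡⟨ cong₂ ℕ._+_ (ℕ.*-identityˡ a) (ℕ.*-identityˡ b) ⟩
    a ℕ.+ b ∎
    where open ℕ.≤-Reasoning

  drift-nonneg : ∀ {s t} a b → 0ℤ ℤ.≤ ⟦ s ⟧ → ⟦ t ⟧ ℤ.≤ 0ℤ → 0ℤ ℤ.≤ drift s t a b
  drift-nonneg a b 0≤s t≤0 =
    ℤ.+-mono-≤ (ℤ.*-monoʳ-≤-nonNeg (+ a) 0≤s) (ℤ.neg-mono-≤ (ℤ.*-monoʳ-≤-nonNeg (+ b) t≤0))

  drift-nonpos : ∀ {s t} a b → ⟦ s ⟧ ℤ.≤ 0ℤ → 0ℤ ℤ.≤ ⟦ t ⟧ → drift s t a b ℤ.≤ 0ℤ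
  drift-nonpos {s} {t} a b s≤0 0≤t =
    subst (ℤ._≤ 0ℤ) (swap (⟦ t ⟧ * + b) (⟦ s ⟧ * + a)) (ℤ.neg-mono-≤ (drift-nonneg b a 0≤t s≤0))
    where
    swap : ∀ x y → - (x - y) ≡ y - x
    swap = solve-∀

  SignExcluded : Slope → Slope → ℤ → Set
  SignExcluded s t d = (0ℤ ℤ.≤ ⟦ s ⟧ × ⟦ t ⟧ ℤ.≤ 0ℤ × d ℤ.< 0ℤ)
                     ⊎ (⟦ s ⟧ ℤ.≤ 0ℤ × 0ℤ ℤ.≤ ⟦ t ⟧ × 0ℤ ℤ.< d)

  signExcluded? : ∀ s t d → Dec (SignExcluded s t d)
  signExcluded? s t d = ((0ℤ ℤ.≤? ⟦ s ⟧) ×-dec (⟦ t ⟧ ℤ.≤? 0ℤ) ×-dec (d ℤ.<? 0ℤ))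
                  ⊎-dec ((⟦ s ⟧ ℤ.≤? 0ℤ) ×-dec (0ℤ ℤ.≤? ⟦ t ⟧) ×-dec (0ℤ ℤ.<? d))

  record Block : Set where
    constructor block
    field
      positive   : Bool
      lead trail : ℕ

  signed : Bool → ℤ → ℤ
  signed true  x = x
  signed false x = - x

  ∣signed∣ : ∀ b n → ∣ signed b (+ n) ∣ ≡ n
  ∣signed∣ true  n = refl
  ∣signed∣ false n = ℤ.∣-i∣≡∣i∣ (+ n)

  slope : Bool → Slope
  slope true  = up
  slope false = down

  signed≡⟦slope⟧* : ∀ b x → signed b x ≡ ⟦ slope b ⟧ * x
  signed≡⟦slope⟧* true  x = sym (ℤ.*-identityˡ x)
  signed≡⟦slope⟧* false x = sym (ℤ.-1*i≡-i x)

  signed-not : ∀ b x → signed (not b) x ≡ - (⟦ slope b ⟧ * x)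
  signed-not true  x = cong -_ (sym (ℤ.*-identityˡ x))
  signed-not false x = trans (sym (ℤ.neg-involutive x)) (cong -_ (sym (ℤ.-1*i≡-i x)))

  net : Block → ℤ
  net (block b p q) = signed b (+ p - + q)

  partialKeys : ℤ → List Block → List Key
  partialKeys k []                     = []
  partialKeys k (B@(block b p _) ∷ Bs) =
    (k + signed b (+ p) , slope b) ∷ (k + net B , flat) ∷ partialKeys (k + net B) Bs

  partialForms : ℤ → List (Block × ℕ) → List Form
  partialForms k []                           = []
  partialForms k ((B@(block b p _) , a) ∷ Bs) =
    ((k + signed b (+ p) , slope b) , a) ∷ ((k + net B , flat) , a) ∷ partialForms (k + net B) Bs

  map-proj₁-partialForms : ∀ k Bs → map proj₁ (partialForms k Bs) ≡ partialKeys k (map proj₁ Bs)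
  map-proj₁-partialForms k []                        = refl
  map-proj₁-partialForms k ((block b p q , a) ∷ Bs) = cong (λ ks → _ ∷ _ ∷ ks) (map-proj₁-partialForms _ Bs)

  partialForms-levels : ∀ {m k Bs} → All ((ℕ._< m) ∘ proj₂) Bs → All ((ℕ._< m) ∘ proj₂) (partialForms k Bs)
  partialForms-levels {Bs = []}                     []           = []
  partialForms-levels {Bs = (block _ _ _ , _) ∷ _} (a<m ∷ a<ms) = a<m ∷ a<m ∷ partialForms-levels a<ms

  module Stride (N : ℕ) where

    value : Form → ℤ
    value ((k , s) , a) = k + ⟦ s ⟧ * (+ N * + a)

    value-gap : ∀ k l s t a b →
                value ((l , t) , b) - value ((k , s) , a) ≡ (l - k) - + N * drift s t a b
    value-gap k l s t a b = gap k l ⟦ s ⟧ ⟦ t ⟧ (+ N) (+ a) (+ b)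
      where
      gap : ∀ k l x y n a b → (l + y * (n * b)) - (k + x * (n * a)) ≡ (l - k) - n * (x * a - y * b)
      gap = solve-∀

    -- Forms with keys (k , s) and (l , t) differ by (l − k) − N · drift s t a b, which cannot vanish
    -- when l − k is not a multiple of N or has a sign that N · drift s t a b never has.
    Separated : Key → Key → Set
    Separated (k , s) (l , t) = ∣ l - k ∣ ℕ.≤ 2 ℕ.* N × (¬ (+ N ∣ l - k) ⊎ SignExcluded s t (l - k))

    separated? : ∀ x y → Dec (Separated x y)
    separated? (k , s) (l , t) =
      (∣ l - k ∣ ℕ.≤? 2 ℕ.* N) ×-dec (¬? (+ N ∣? l - k) ⊎-dec signExcluded? s t (l - k))

    N*-nonneg : ∀ {w} → 0ℤ ℤ.≤ w → 0ℤ ℤ.≤ + N * w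
    N*-nonneg {w} 0≤w = subst (ℤ._≤ + N * w) (ℤ.*-zeroʳ (+ N)) (ℤ.*-monoˡ-≤-nonNeg (+ N) 0≤w)

    N*-nonpos : ∀ {w} → w ℤ.≤ 0ℤ → + N * w ℤ.≤ 0ℤ
    N*-nonpos {w} w≤0 = subst (+ N * w ℤ.≤_) (ℤ.*-zeroʳ (+ N)) (ℤ.*-monoˡ-≤-nonNeg (+ N) w≤0)

    separated⇒≢ : ∀ {k l s t} a b → Separated (k , s) (l , t) → l - k ≢ + N * drift s t a b
    separated⇒≢ {s = s} {t} a b (_ , inj₁ N∤d) d≡Nw =
      N∤d (divides (drift s t a b) (trans d≡Nw (ℤ.*-comm (+ N) (drift s t a b))))
    separated⇒≢ a b (_ , inj₂ (inj₁ (0≤s , t≤0 , d<0))) d≡Nw =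
      ℤ.<⇒≱ d<0 (subst (0ℤ ℤ.≤_) (sym d≡Nw) (N*-nonneg (drift-nonneg a b 0≤s t≤0)))
    separated⇒≢ a b (_ , inj₂ (inj₂ (s≤0 , 0≤t , 0<d))) d≡Nw =
      ℤ.<⇒≱ 0<d (subst (ℤ._≤ 0ℤ) (sym d≡Nw) (N*-nonpos (drift-nonpos a b s≤0 0≤t)))

    module _ {m V : ℕ} .{{_ : NonZero V}} (2Nm<V : 2 ℕ.* N ℕ.* m ℕ.< V) where

      values-close : ∀ {k l s t a b} → ∣ l - k ∣ ℕ.≤ 2 ℕ.* N → a ℕ.< m → b ℕ.< m →
                     ∣ value ((l , t) , b) - value ((k , s) , a) ∣ ℕ.< V
      values-close {k} {l} {s} {t} {a} {b} ∣l-k∣≤2N a<m b<m = ℕ.≤-<-trans (begin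
        ∣ value ((l , t) , b) - value ((k , s) , a) ∣
          ≡⟨ cong ∣_∣ (value-gap k l s t a b) ⟩
        ∣ (l - k) - + N * drift s t a b ∣
          ≤⟨ ℤ.∣i-j∣≤∣i∣+∣j∣ (l - k) (+ N * drift s t a b) ⟩
        ∣ l - k ∣ ℕ.+ ∣ + N * drift s t a b ∣
          ≡⟨ cong (∣ l - k ∣ ℕ.+_) (ℤ.abs-* (+ N) (drift s t a b)) ⟩
        ∣ l - k ∣ ℕ.+ N ℕ.* ∣ drift s t a b ∣
          ≤⟨ ℕ.+-mono-≤ ∣l-k∣≤2N (ℕ.*-monoʳ-≤ N (∣drift∣≤ s t a b)) ⟩
        2 ℕ.* N ℕ.+ N ℕ.* (a ℕ.+ b)
          ≡⟨ regroup N a b ⟩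
        N ℕ.* (suc a ℕ.+ suc b)
          ≤⟨ ℕ.*-monoʳ-≤ N (ℕ.+-mono-≤ a<m b<m) ⟩
        N ℕ.* (m ℕ.+ m)
          ≡⟨ double N m ⟩
        2 ℕ.* N ℕ.* m ∎) 2Nm<V
        where
        open ℕ.≤-Reasoning
        regroup : ∀ N a b → 2 ℕ.* N ℕ.+ N ℕ.* (a ℕ.+ b) ≡ N ℕ.* (suc a ℕ.+ suc b)
        regroup = ℕ-Solver.solve-∀
        double : ∀ N m → N ℕ.* (m ℕ.+ m) ≡ 2 ℕ.* N ℕ.* m
        double = ℕ-Solver.solve-∀

      separated⇒≢%ℕ : ∀ {f g} → proj₂ f ℕ.< m → proj₂ g ℕ.< m → Separated (proj₁ f) (proj₁ g) →
                      value f %ℕ V ≢ value g %ℕ V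
      separated⇒≢%ℕ {(k , s) , a} {(l , t) , b} a<m b<m sep@(∣l-k∣≤2N , _) f≡g =
        separated⇒≢ {k} {l} {s} {t} a b sep (ℤ.i-j≡0⇒i≡j (l - k) (+ N * drift s t a b) (begin
          (l - k) - + N * drift s t a b               ≡⟨ value-gap k l s t a b ⟨
          value ((l , t) , b) - value ((k , s) , a)   ≡⟨ ℤ.i≡j⇒i-j≡0 g≡f ⟩
          0ℤ                                          ∎))
        where
        open ≡-Reasoning
        g≡f : value ((l , t) , b) ≡ value ((k , s) , a)
        g≡f = congruent∧close⇒≡ (value ((l , t) , b)) (value ((k , s) , a)) V (sym f≡g)
                (values-close {k} {l} {s} {t} ∣l-k∣≤2N a<m b<m)

    blockEntries : Block × ℕ → List ℤ
    blockEntries (block b p q , a) = signed b (+ (p ℕ.+ N ℕ.* a)) ∷ signed (not b) (+ (q ℕ.+ N ℕ.* a)) ∷ []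

    expand : List (Block × ℕ) → List ℤ
    expand = concatMap blockEntries

    +[p+N*a] : ∀ p a → + (p ℕ.+ N ℕ.* a) ≡ + p + + N * + a
    +[p+N*a] p a = trans (ℤ.pos-+ p (N ℕ.* a)) (cong (λ z → + p + z) (ℤ.pos-* N a))

    first-partialSum : ∀ k b p a →
                       k + signed b (+ (p ℕ.+ N ℕ.* a)) ≡ value ((k + signed b (+ p) , slope b) , a)
    first-partialSum k b p a = begin
      k + signed b (+ (p ℕ.+ N ℕ.* a))
        ≡⟨ cong (_+_ k) (trans (signed≡⟦slope⟧* b _) (cong (⟦ slope b ⟧ *_) (+[p+N*a] p a))) ⟩
      k + ⟦ slope b ⟧ * (+ p + + N * + a)
        ≡⟨ distrib k ⟦ slope b ⟧ (+ p) (+ N * + a) ⟩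
      (k + ⟦ slope b ⟧ * + p) + ⟦ slope b ⟧ * (+ N * + a)
        ≡⟨ cong (λ z → (k + z) + ⟦ slope b ⟧ * (+ N * + a)) (signed≡⟦slope⟧* b (+ p)) ⟨
      value ((k + signed b (+ p) , slope b) , a) ∎
      where
      open ≡-Reasoning
      distrib : ∀ k x u v → k + x * (u + v) ≡ (k + x * u) + x * v
      distrib = solve-∀

    blockEntries-sum : ∀ b p q a →
                       signed b (+ (p ℕ.+ N ℕ.* a)) + signed (not b) (+ (q ℕ.+ N ℕ.* a)) ≡ net (block b p q)
    blockEntries-sum b p q a = begin
      signed b (+ (p ℕ.+ N ℕ.* a)) + signed (not b) (+ (q ℕ.+ N ℕ.* a))
        ≡⟨ cong₂ _+_ (trans (signed≡⟦slope⟧* b _) (cong (x *_) (+[p+N*a] p a)))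
                     (trans (signed-not b _) (cong (λ z → - (x * z)) (+[p+N*a] q a))) ⟩
      x * (+ p + + N * + a) + - (x * (+ q + + N * + a))
        ≡⟨ cancel x (+ p) (+ q) (+ N * + a) ⟩
      x * (+ p - + q)
        ≡⟨ signed≡⟦slope⟧* b (+ p - + q) ⟨
      net (block b p q) ∎
      where
      open ≡-Reasoning
      x : ℤ
      x = ⟦ slope b ⟧
      cancel : ∀ x u v w → x * (u + w) + - (x * (v + w)) ≡ x * (u - v)
      cancel = solve-∀

    partialSums-expand : ∀ k Bs → partialSumsFrom k (expand Bs) ≡ map value (partialForms k Bs)
    partialSums-expand k []                        = refl
    partialSums-expand k ((block b p q , a) ∷ Bs) =
      cong₂ _∷_ (first-partialSum k b p a)
        (cong₂ _∷_ (trans second (sym (ℤ.+-identityʳ _)))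
          (trans (cong (λ z → partialSumsFrom z (expand Bs)) second) (partialSums-expand _ Bs)))
      where
      second : (k + signed b (+ (p ℕ.+ N ℕ.* a))) + signed (not b) (+ (q ℕ.+ N ℕ.* a)) ≡ k + net (block b p q)
      second = trans (ℤ.+-assoc k _ _) (cong (_+_ k) (blockEntries-sum b p q a))

    sumℤ-expand : ∀ Bs → sumℤ (expand Bs) ≡ sumℤ (map net (map proj₁ Bs))
    sumℤ-expand []                        = refl
    sumℤ-expand ((block b p q , a) ∷ Bs) =
      trans (sym (ℤ.+-assoc (signed b (+ (p ℕ.+ N ℕ.* a))) (signed (not b) (+ (q ℕ.+ N ℕ.* a)))
                            (sumℤ (expand Bs))))
            (cong₂ _+_ (blockEntries-sum b p q a) (sumℤ-expand Bs))

    length-expand : ∀ Bs → length (expand Bs) ≡ 2 ℕ.* length Bs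
    length-expand []       = refl
    length-expand (_ ∷ Bs) = trans (cong (2 ℕ.+_) (length-expand Bs)) (sym (ℕ.*-suc 2 (length Bs)))

    record ZeroSumSimple (k m : ℕ) (xs : List ℤ) : Set where
      field
        length≡ : length xs ≡ k
        sum≡0   : sumℤ xs ≡ 0ℤ
        simple  : ∀ V .{{_ : NonZero V}} → 2 ℕ.* N ℕ.* m ℕ.< V → SimpleMod V xs

    Admissible : List Block → Set
    Admissible Bs = sumℤ (map net Bs) ≡ 0ℤ × AllPairs Separated (partialKeys 0ℤ Bs)

    admissible? : ∀ Bs → Dec (Admissible Bs)
    admissible? Bs = (sumℤ (map net Bs) ℤ.≟ 0ℤ) ×-dec allPairs? separated? (partialKeys 0ℤ Bs)

    expand-zeroSumSimple : ∀ {m} Bs → All ((ℕ._< m) ∘ proj₂) Bs → Admissible (map proj₁ Bs) →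
                           ZeroSumSimple (2 ℕ.* length Bs) m (expand Bs)
    expand-zeroSumSimple {m} Bs levels (sum≡0 , separated) = record
      { length≡ = length-expand Bs
      ; sum≡0   = trans (sumℤ-expand Bs) sum≡0
      ; simple  = λ V 2Nm<V →
          subst (λ ss → AllPairs _≢_ (map (_%ℕ V) ss)) (sym partialSums≡)
                (AllPairs.map⁺ (AllPairs.map⁺ (distinct 2Nm<V)))
      }
      where
      partialSums≡ : partialSums (expand Bs) ≡ map value (partialForms 0ℤ Bs)
      partialSums≡ = trans (partialSums≡partialSumsFrom0 (expand Bs)) (partialSums-expand 0ℤ Bs)
      distinct : ∀ {V} .{{_ : NonZero V}} → 2 ℕ.* N ℕ.* m ℕ.< V →
                 AllPairs (λ f g → value f %ℕ V ≢ value g %ℕ V) (partialForms 0ℤ Bs)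
      distinct 2Nm<V = allPairs-mapWith-All (λ {f} {g} → separated⇒≢%ℕ 2Nm<V {f} {g}) (partialForms-levels levels)
        (AllPairs.map⁻ (subst (AllPairs Separated) (sym (map-proj₁-partialForms 0ℤ Bs)) separated))

module Indexing where

  open import Data.Empty using (⊥-elim)
  open import Data.Fin as Fin using (Fin; zero; suc; toℕ)
  import Data.Fin.Properties as Fin
  open import Data.List using (List; []; _∷_; _++_; map; mapMaybe; catMaybes; concatMap; allFin; tabulate)
  import Data.List.Properties as List
  open import Data.List.Relation.Unary.All using (All; []; _∷_)
  open import Data.List.Relation.Unary.AllPairs using ([]; _∷_)
  open import Data.List.Relation.Unary.Unique.Propositional using (Unique)
  open import Data.Maybe as Maybe using (Maybe; just; nothing; maybe′)
  open import Data.Nat as ℕ using (ℕ; zero; suc; _+_; _*_; _∸_; _⊓_; _<_; _≤_; z≤n; s≤s)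
  import Data.Nat.Properties as ℕ
  open import Data.Nat.Tactic.RingSolver using (solve-∀)
  open import Data.Product using (Σ; _×_; _,_; proj₁; proj₂; map₁)
  open import Data.Sum using (_⊎_; inj₁; inj₂)
  open import Function using (_∘_; id)
  open import Relation.Binary using (tri<; tri≈; tri>)
  open import Relation.Binary.PropositionalEquality
  open import Relation.Nullary using (¬_; yes; no)

  range : ℕ → ℕ → List ℕ
  range s zero    = []
  range s (suc k) = s ∷ range (suc s) k

  rangeDown : ℕ → ℕ → List ℕ
  rangeDown s zero    = []
  rangeDown s (suc k) = s + k ∷ rangeDown s k

  range-+ : ∀ s a b → range s (a + b) ≡ range s a ++ range (s + a) b
  range-+ s zero    b = cong (λ t → range t b) (sym (ℕ.+-identityʳ s))
  range-+ s (suc a) b =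
    cong (s ∷_) (trans (range-+ (suc s) a b) (cong (λ t → range (suc s) a ++ range t b) (sym (ℕ.+-suc s a))))

  rangeDown-+ : ∀ s a b → rangeDown s (b + a) ≡ rangeDown (s + a) b ++ rangeDown s a
  rangeDown-+ s a zero    = refl
  rangeDown-+ s a (suc b) = cong₂ _∷_ (regroup s a b) (rangeDown-+ s a b)
    where
    regroup : ∀ s a b → s + (b + a) ≡ s + a + b
    regroup = solve-∀

  map-range : ∀ {A : Set} {f : ℕ → A} {g : ℕ → A} s t k → (∀ x → x < k → f (s + x) ≡ g (t + x)) →
              map f (range s k) ≡ map g (range t k)
  map-range s t zero    _ = refl
  map-range {f = f} {g} s t (suc k) f≡g = cong₂ _∷_
    (subst₂ (λ u v → f u ≡ g v) (ℕ.+-identityʳ s) (ℕ.+-identityʳ t) (f≡g 0 (s≤s z≤n)))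
    (map-range (suc s) (suc t) k λ x x<k →
      subst₂ (λ u v → f u ≡ g v) (ℕ.+-suc s x) (ℕ.+-suc t x) (f≡g (suc x) (s≤s x<k)))

  map-range-down : ∀ {A : Set} {f : ℕ → A} {g : ℕ → A} s t k →
                   (∀ x → x < k → f (s + x) ≡ g (t + (k ∸ suc x))) →
                   map f (range s k) ≡ map g (rangeDown t k)
  map-range-down s t zero    _ = refl
  map-range-down {f = f} {g} s t (suc k) f≡g = cong₂ _∷_
    (subst (λ u → f u ≡ g (t + k)) (ℕ.+-identityʳ s) (f≡g 0 (s≤s z≤n)))
    (map-range-down (suc s) t k λ x x<k →
      subst (λ u → f u ≡ g (t + (k ∸ suc x))) (ℕ.+-suc s x) (f≡g (suc x) (s≤s x<k)))

  toFin? : ∀ {w} → ℕ → Maybe (Fin w)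
  toFin? {zero}  _       = nothing
  toFin? {suc w} zero    = just zero
  toFin? {suc w} (suc d) = Maybe.map suc (toFin? d)

  toFin?-≥ : ∀ {w} d → w ≤ d → toFin? {w} d ≡ nothing
  toFin?-≥ {zero}  d       _         = refl
  toFin?-≥ {suc w} (suc d) (s≤s w≤d) = cong (Maybe.map suc) (toFin?-≥ d w≤d)

  toFin?-just : ∀ {w} d {δ : Fin w} → toFin? d ≡ just δ → toℕ δ ≡ d
  toFin?-just {suc w} zero    refl = refl
  toFin?-just {suc w} (suc d) eq with toFin? {w} d in e
  toFin?-just {suc w} (suc d) refl | just δ = cong suc (toFin?-just d e)

  mapMaybe-toFin?-range-≥ : ∀ {w} s k → w ≤ s → mapMaybe (toFin? {w}) (range s k) ≡ []
  mapMaybe-toFin?-range-≥ s zero    _   = refl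
  mapMaybe-toFin?-range-≥ s (suc k) w≤s rewrite toFin?-≥ s w≤s =
    mapMaybe-toFin?-range-≥ (suc s) k (ℕ.m≤n⇒m≤1+n w≤s)

  mapMaybe-toFin?-rangeDown-≥ : ∀ {w} s k → w ≤ s → mapMaybe (toFin? {w}) (rangeDown s k) ≡ []
  mapMaybe-toFin?-rangeDown-≥ s zero    _   = refl
  mapMaybe-toFin?-rangeDown-≥ s (suc k) w≤s rewrite toFin?-≥ (s + k) (ℕ.≤-trans w≤s (ℕ.m≤m+n s k)) =
    mapMaybe-toFin?-rangeDown-≥ s k w≤s

  window-range : ∀ {w} s k → w ≤ s + k →
                 mapMaybe (toFin? {w}) (range s k) ≡ mapMaybe toFin? (range s (w ∸ s))
  window-range {w} s k w≤s+k = begin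
    mapMaybe toFin? (range s k)
      ≡⟨ cong (mapMaybe toFin? ∘ range s) (sym (ℕ.m+[n∸m]≡n w∸s≤k)) ⟩
    mapMaybe toFin? (range s (w ∸ s + e))
      ≡⟨ cong (mapMaybe toFin?) (range-+ s (w ∸ s) e) ⟩
    mapMaybe toFin? (range s (w ∸ s) ++ range (s + (w ∸ s)) e)
      ≡⟨ List.mapMaybe-++ toFin? (range s (w ∸ s)) _ ⟩
    mapMaybe toFin? (range s (w ∸ s)) ++ mapMaybe toFin? (range (s + (w ∸ s)) e)
      ≡⟨ cong (mapMaybe toFin? (range s (w ∸ s)) ++_) (mapMaybe-toFin?-range-≥ _ e (ℕ.m≤n+m∸n w s)) ⟩
    mapMaybe toFin? (range s (w ∸ s)) ++ []
      ≡⟨ List.++-identityʳ _ ⟩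
    mapMaybe toFin? (range s (w ∸ s)) ∎
    where
    open ≡-Reasoning
    w∸s≤k : w ∸ s ≤ k
    w∸s≤k = subst (w ∸ s ≤_) (ℕ.m+n∸m≡n s k) (ℕ.∸-monoˡ-≤ s w≤s+k)
    e : ℕ
    e = k ∸ (w ∸ s)

  window-rangeDown : ∀ {w} s k → w ≤ s + k →
                     mapMaybe (toFin? {w}) (rangeDown s k) ≡ mapMaybe toFin? (rangeDown s (w ∸ s))
  window-rangeDown {w} s k w≤s+k = begin
    mapMaybe toFin? (rangeDown s k)
      ≡⟨ cong (mapMaybe toFin? ∘ rangeDown s) (sym (ℕ.m∸n+n≡m w∸s≤k)) ⟩
    mapMaybe toFin? (rangeDown s (e + (w ∸ s)))
      ≡⟨ cong (mapMaybe toFin?) (rangeDown-+ s (w ∸ s) e) ⟩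
    mapMaybe toFin? (rangeDown (s + (w ∸ s)) e ++ rangeDown s (w ∸ s))
      ≡⟨ List.mapMaybe-++ toFin? (rangeDown (s + (w ∸ s)) e) _ ⟩
    mapMaybe toFin? (rangeDown (s + (w ∸ s)) e) ++ mapMaybe toFin? (rangeDown s (w ∸ s))
      ≡⟨ cong (_++ mapMaybe toFin? (rangeDown s (w ∸ s))) (mapMaybe-toFin?-rangeDown-≥ _ e (ℕ.m≤n+m∸n w s)) ⟩
    mapMaybe toFin? (rangeDown s (w ∸ s)) ∎
    where
    open ≡-Reasoning
    w∸s≤k : w ∸ s ≤ k
    w∸s≤k = subst (w ∸ s ≤_) (ℕ.m+n∸m≡n s k) (ℕ.∸-monoˡ-≤ s w≤s+k)
    e : ℕ
    e = k ∸ (w ∸ s)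

  tabulate-toℕ : ∀ s n → tabulate {n = n} (λ i → s + toℕ i) ≡ range s n
  tabulate-toℕ s zero    = refl
  tabulate-toℕ s (suc n) = cong₂ _∷_ (ℕ.+-identityʳ s)
    (trans (List.tabulate-cong (λ i → ℕ.+-suc s (toℕ i))) (tabulate-toℕ (suc s) n))

  mapMaybe-allFin : ∀ {A : Set} n (H : ℕ → Maybe A) → mapMaybe (H ∘ toℕ) (allFin n) ≡ mapMaybe H (range 0 n)
  mapMaybe-allFin n H = begin
    mapMaybe (H ∘ toℕ) (allFin n)      ≡⟨ List.mapMaybe-map H toℕ (allFin n) ⟨
    mapMaybe H (map toℕ (allFin n))    ≡⟨ cong (mapMaybe H) (trans (List.map-tabulate id toℕ) (tabulate-toℕ 0 n)) ⟩
    mapMaybe H (range 0 n)             ∎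
    where open ≡-Reasoning

  mapMaybe-pairs : ∀ {A : Set} (H : ℕ → Maybe A) s k →
                   mapMaybe H (range (2 * s) (2 * k))
                   ≡ concatMap (λ J → catMaybes (H (2 * J) ∷ H (suc (2 * J)) ∷ [])) (range s k)
  mapMaybe-pairs H s zero    = refl
  mapMaybe-pairs H s (suc k) = begin
    mapMaybe H (range (2 * s) (2 * suc k))
      ≡⟨ cong (mapMaybe H ∘ range (2 * s)) (ℕ.*-suc 2 k) ⟩
    catMaybes (H (2 * s) ∷ H (suc (2 * s)) ∷ map H (range (2 + 2 * s) (2 * k)))
      ≡⟨ List.catMaybes-++ (H (2 * s) ∷ H (suc (2 * s)) ∷ []) (map H (range (2 + 2 * s) (2 * k))) ⟩
    catMaybes (H (2 * s) ∷ H (suc (2 * s)) ∷ []) ++ mapMaybe H (range (2 + 2 * s) (2 * k))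
      ≡⟨ cong (λ t → catMaybes (H (2 * s) ∷ H (suc (2 * s)) ∷ []) ++ mapMaybe H (range t (2 * k)))
              (sym (ℕ.*-suc 2 s)) ⟩
    catMaybes (H (2 * s) ∷ H (suc (2 * s)) ∷ []) ++ mapMaybe H (range (2 * suc s) (2 * k))
      ≡⟨ cong (catMaybes (H (2 * s) ∷ H (suc (2 * s)) ∷ []) ++_) (mapMaybe-pairs H (suc s) k) ⟩
    concatMap (λ J → catMaybes (H (2 * J) ∷ H (suc (2 * J)) ∷ [])) (range s (suc k)) ∎
    where open ≡-Reasoning

  concatMap-maybe : ∀ {A B C : Set} (F : B → List C) (h : A → Maybe B) xs →
                    concatMap (maybe′ F [] ∘ h) xs ≡ concatMap F (mapMaybe h xs)
  concatMap-maybe F h []       = refl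
  concatMap-maybe F h (x ∷ xs) with h x
  ... | just y  = cong (F y ++_) (concatMap-maybe F h xs)
  ... | nothing = concatMap-maybe F h xs

  -- offset m I J = (J − I) mod m for I , J < m.
  offset : ℕ → ℕ → ℕ → ℕ
  offset m zero    J       = J
  offset m (suc I) zero    = m ∸ suc I
  offset m (suc I) (suc J) = offset m I J

  offset-+ : ∀ m I x → offset m I (I + x) ≡ x
  offset-+ m zero    x = refl
  offset-+ m (suc I) x = offset-+ m I x

  offset-wrap : ∀ m I J u → I + u ≡ m → J < I → offset m I J ≡ u + J
  offset-wrap m (suc I) zero    u refl _           = trans (ℕ.m+n∸m≡n (suc I) u) (sym (ℕ.+-identityʳ u))
  offset-wrap m (suc I) (suc J) u I+u≡m (s≤s J<I) =
    trans (offset-wrap m I J (suc u) (trans (ℕ.+-suc I u) I+u≡m) J<I) (sym (ℕ.+-suc u J))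

  offset-< : ∀ m I J → J < m → offset m I J < m
  offset-< m       zero    J       J<m = J<m
  offset-< (suc m) (suc I) zero    _   = s≤s (ℕ.m∸n≤m m I)
  offset-< m       (suc I) (suc J) J<m = offset-< m I J (ℕ.<-trans (ℕ.n<1+n J) J<m)

  offset-spec : ∀ m I J → I < m → (I + offset m I J ≡ J) ⊎ (I + offset m I J ≡ J + m)
  offset-spec m I J I<m with I ℕ.≤? J
  ... | yes I≤J = inj₁ (begin
    I + offset m I J                ≡⟨ cong (λ K → I + offset m I K) (sym (ℕ.m+[n∸m]≡n I≤J)) ⟩
    I + offset m I (I + (J ∸ I))    ≡⟨ cong (I +_) (offset-+ m I (J ∸ I)) ⟩
    I + (J ∸ I)                     ≡⟨ ℕ.m+[n∸m]≡n I≤J ⟩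
    J                               ∎)
    where open ≡-Reasoning
  ... | no I≰J = inj₂ (begin
    I + offset m I J                ≡⟨ cong (I +_) (offset-wrap m I J (m ∸ I) I+[m∸I]≡m (ℕ.≰⇒> I≰J)) ⟩
    I + ((m ∸ I) + J)               ≡⟨ ℕ.+-assoc I (m ∸ I) J ⟨
    (I + (m ∸ I)) + J               ≡⟨ cong (_+ J) I+[m∸I]≡m ⟩
    m + J                           ≡⟨ ℕ.+-comm m J ⟩
    J + m                           ∎)
    where
    open ≡-Reasoning
    I+[m∸I]≡m : I + (m ∸ I) ≡ m
    I+[m∸I]≡m = ℕ.m+[n∸m]≡n (ℕ.<⇒≤ I<m)

  m<n⇒m≢o+n : ∀ {m n o} → m < n → m ≢ o + n
  m<n⇒m≢o+n {m} {n} {o} m<n m≡o+n = ℕ.<⇒≱ m<n (subst (n ≤_) (sym m≡o+n) (ℕ.m≤n+m n o))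

  offset-injective : ∀ m I J J' → I < m → J < m → J' < m → offset m I J ≡ offset m I J' → J ≡ J'
  offset-injective m I J J' I<m J<m J'<m eq with offset-spec m I J I<m | offset-spec m I J' I<m
  ... | inj₁ p | inj₁ q = trans (sym p) (trans (cong (I +_) eq) q)
  ... | inj₂ p | inj₂ q = ℕ.+-cancelʳ-≡ m J J' (trans (sym p) (trans (cong (I +_) eq) q))
  ... | inj₁ p | inj₂ q = ⊥-elim (m<n⇒m≢o+n J<m (trans (sym p) (trans (cong (I +_) eq) q)))
  ... | inj₂ p | inj₁ q = ⊥-elim (m<n⇒m≢o+n J'<m (trans (sym q) (trans (cong (I +_) (sym eq)) p)))

  halve : ℕ → ℕ × Fin 2
  halve zero          = 0 , zero
  halve (suc zero)    = 0 , suc zero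
  halve (suc (suc i)) = map₁ suc (halve i)

  halve-2* : ∀ J → halve (2 * J) ≡ (J , zero)
  halve-2* zero    = refl
  halve-2* (suc J) = trans (cong halve (ℕ.*-suc 2 J)) (cong (map₁ suc) (halve-2* J))

  halve-1+2* : ∀ J → halve (suc (2 * J)) ≡ (J , suc zero)
  halve-1+2* zero    = refl
  halve-1+2* (suc J) = trans (cong (halve ∘ suc) (ℕ.*-suc 2 J)) (cong (map₁ suc) (halve-1+2* J))

  halve-spec : ∀ i → toℕ (proj₂ (halve i)) + 2 * proj₁ (halve i) ≡ i
  halve-spec zero          = refl
  halve-spec (suc zero)    = refl
  halve-spec (suc (suc i)) = trans (shift (toℕ (proj₂ (halve i))) (proj₁ (halve i))) (cong (2 +_) (halve-spec i))
    where
    shift : ∀ r I → r + 2 * suc I ≡ 2 + (r + 2 * I)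
    shift = solve-∀

  halve-< : ∀ {m} i → i < 2 * m → proj₁ (halve i) < m
  halve-< {m} i i<2m = ℕ.*-cancelˡ-< 2 I m (ℕ.≤-<-trans 2I≤i i<2m)
    where
    I : ℕ
    I = proj₁ (halve i)
    2I≤i : 2 * I ≤ i
    2I≤i = subst (2 * I ≤_) (halve-spec i) (ℕ.m≤n+m (2 * I) (toℕ (proj₂ (halve i))))

  halve-injective : ∀ i i' → halve i ≡ halve i' → i ≡ i'
  halve-injective i i' eq =
    trans (sym (halve-spec i)) (trans (cong (λ h → toℕ (proj₂ h) + 2 * proj₁ h) eq) (halve-spec i'))

  -- The orders t, …, w − 1, 0, …, t − 1 and t − 1, …, 0, w − 1, …, t in which a row, respectively a
  -- column, meets the w filled blocks.
  cyclicUp : ∀ w → ℕ → List (Fin w)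
  cyclicUp w t = mapMaybe toFin? (range t (w ∸ t) ++ range 0 t)

  cyclicDown : ∀ w → ℕ → List (Fin w)
  cyclicDown w t = mapMaybe toFin? (rangeDown 0 t ++ rangeDown t (w ∸ t))

  row-offsets : ∀ I u → map (offset (I + u) I) (range 0 (I + u)) ≡ range u I ++ range 0 u
  row-offsets I u = begin
    map f (range 0 (I + u))                ≡⟨ cong (map f) (range-+ 0 I u) ⟩
    map f (range 0 I ++ range I u)         ≡⟨ List.map-++ f (range 0 I) (range I u) ⟩
    map f (range 0 I) ++ map f (range I u) ≡⟨ cong₂ _++_ wrapped unwrapped ⟩
    map id (range u I) ++ map id (range 0 u) ≡⟨ cong₂ _++_ (List.map-id (range u I)) (List.map-id (range 0 u)) ⟩
    range u I ++ range 0 u                 ∎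
    where
    open ≡-Reasoning
    f : ℕ → ℕ
    f = offset (I + u) I
    wrapped : map f (range 0 I) ≡ map id (range u I)
    wrapped = map-range 0 u I (λ x x<I → offset-wrap (I + u) I x u refl x<I)
    unwrapped : map f (range I u) ≡ map id (range 0 u)
    unwrapped = map-range I 0 u (λ x _ → offset-+ (I + u) I x)

  row-window : ∀ {w} I u → w ≤ I + u → mapMaybe (toFin? {w}) (range u I ++ range 0 u) ≡ cyclicUp w (u ⊓ w)
  row-window {w} I u w≤I+u with ℕ.≤-total u w
  ... | inj₁ u≤w rewrite ℕ.m≤n⇒m⊓n≡m u≤w = begin
    mapMaybe toFin? (range u I ++ range 0 u)
      ≡⟨ List.mapMaybe-++ toFin? (range u I) (range 0 u) ⟩
    mapMaybe toFin? (range u I) ++ mapMaybe toFin? (range 0 u)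
      ≡⟨ cong (_++ mapMaybe toFin? (range 0 u)) (window-range u I (subst (w ≤_) (ℕ.+-comm I u) w≤I+u)) ⟩
    mapMaybe toFin? (range u (w ∸ u)) ++ mapMaybe toFin? (range 0 u)
      ≡⟨ List.mapMaybe-++ toFin? (range u (w ∸ u)) (range 0 u) ⟨
    cyclicUp w u ∎
    where open ≡-Reasoning
  ... | inj₂ w≤u rewrite ℕ.m≥n⇒m⊓n≡n w≤u = begin
    mapMaybe toFin? (range u I ++ range 0 u)
      ≡⟨ List.mapMaybe-++ toFin? (range u I) (range 0 u) ⟩
    mapMaybe toFin? (range u I) ++ mapMaybe toFin? (range 0 u)
      ≡⟨ cong₂ _++_ (mapMaybe-toFin?-range-≥ u I w≤u) (window-range 0 u w≤u) ⟩
    mapMaybe toFin? (range 0 w)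
      ≡⟨ cong (λ k → mapMaybe toFin? (range w k ++ range 0 w)) (ℕ.n∸n≡0 w) ⟨
    cyclicUp w w ∎
    where open ≡-Reasoning

  col-offsets : ∀ J v → map (λ I → offset (suc J + v) I J , I) (range 0 (suc J + v))
                      ≡ map (λ d → d , offset (suc J + v) d J) (rangeDown 0 (suc J) ++ rangeDown (suc J) v)
  col-offsets J v = begin
    map f (range 0 (suc J + v))
      ≡⟨ cong (map f) (range-+ 0 (suc J) v) ⟩
    map f (range 0 (suc J) ++ range (suc J) v)
      ≡⟨ List.map-++ f (range 0 (suc J)) (range (suc J) v) ⟩
    map f (range 0 (suc J)) ++ map f (range (suc J) v)
      ≡⟨ cong₂ _++_ (map-range-down 0 0 (suc J) above) (map-range-down (suc J) (suc J) v below) ⟩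
    map g (rangeDown 0 (suc J)) ++ map g (rangeDown (suc J) v)
      ≡⟨ List.map-++ g (rangeDown 0 (suc J)) (rangeDown (suc J) v) ⟨
    map g (rangeDown 0 (suc J) ++ rangeDown (suc J) v) ∎
    where
    open ≡-Reasoning
    m : ℕ
    m = suc J + v
    f : ℕ → ℕ × ℕ
    f I = offset m I J , I
    g : ℕ → ℕ × ℕ
    g d = d , offset m d J
    above : ∀ x → x < suc J → f x ≡ g (J ∸ x)
    above x (s≤s x≤J) = cong₂ _,_
      (trans (cong (offset m x) (sym (ℕ.m+[n∸m]≡n x≤J))) (offset-+ m x (J ∸ x)))
      (sym (trans (cong (offset m (J ∸ x)) (sym (ℕ.m∸n+n≡m x≤J))) (offset-+ m (J ∸ x) x)))
    below : ∀ x → x < v → f (suc J + x) ≡ g (suc J + (v ∸ suc x))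
    below x x<v with ℕ.m≤n⇒∃[o]m+o≡n x<v
    ... | e , refl rewrite ℕ.m+n∸m≡n (suc x) e = cong₂ _,_
      (trans (offset-wrap m (suc J + x) J (suc e) (regroup₁ J x e) (ℕ.m≤m+n (suc J) x)) (swap e J))
      (sym (trans (offset-wrap m (suc J + e) J (suc x) (regroup₂ J x e)
                               (ℕ.m≤m+n (suc J) e))
                  (swap x J)))
      where
      regroup₁ : ∀ J x e → suc J + x + suc e ≡ suc J + (suc x + e)
      regroup₁ = solve-∀
      regroup₂ : ∀ J x e → suc J + e + suc x ≡ suc J + (suc x + e)
      regroup₂ = solve-∀
      swap : ∀ e J → suc e + J ≡ suc J + e
      swap = solve-∀

  col-window : ∀ {w} J v → w ≤ suc J + v →
               mapMaybe (toFin? {w}) (rangeDown 0 (suc J) ++ rangeDown (suc J) v) ≡ cyclicDown w (suc J ⊓ w)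
  col-window {w} J v w≤m with ℕ.≤-total (suc J) w
  ... | inj₁ J<w rewrite ℕ.m≤n⇒m⊓n≡m J<w = begin
    mapMaybe toFin? (rangeDown 0 (suc J) ++ rangeDown (suc J) v)
      ≡⟨ List.mapMaybe-++ toFin? (rangeDown 0 (suc J)) (rangeDown (suc J) v) ⟩
    mapMaybe toFin? (rangeDown 0 (suc J)) ++ mapMaybe toFin? (rangeDown (suc J) v)
      ≡⟨ cong (mapMaybe toFin? (rangeDown 0 (suc J)) ++_) (window-rangeDown (suc J) v w≤m) ⟩
    mapMaybe toFin? (rangeDown 0 (suc J)) ++ mapMaybe toFin? (rangeDown (suc J) (w ∸ suc J))
      ≡⟨ List.mapMaybe-++ toFin? (rangeDown 0 (suc J)) (rangeDown (suc J) (w ∸ suc J)) ⟨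
    cyclicDown w (suc J) ∎
    where open ≡-Reasoning
  ... | inj₂ w≤J rewrite ℕ.m≥n⇒m⊓n≡n w≤J = begin
    mapMaybe toFin? (rangeDown 0 (suc J) ++ rangeDown (suc J) v)
      ≡⟨ List.mapMaybe-++ toFin? (rangeDown 0 (suc J)) (rangeDown (suc J) v) ⟩
    mapMaybe toFin? (rangeDown 0 (suc J)) ++ mapMaybe toFin? (rangeDown (suc J) v)
      ≡⟨ cong₂ _++_ (window-rangeDown 0 (suc J) w≤J) (mapMaybe-toFin?-rangeDown-≥ (suc J) v w≤J) ⟩
    mapMaybe toFin? (rangeDown 0 w) ++ []
      ≡⟨ List.mapMaybe-++ toFin? (rangeDown 0 w) [] ⟨
    mapMaybe toFin? (rangeDown 0 w ++ [])
      ≡⟨ cong (λ k → mapMaybe toFin? (rangeDown 0 w ++ rangeDown w k)) (ℕ.n∸n≡0 w) ⟨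
    cyclicDown w w ∎
    where open ≡-Reasoning

  digit-< : ∀ N {a a' b b'} → b ≤ N → 1 ≤ b' → a < a' → b + N * a < b' + N * a'
  digit-< N {a} {a'} {b} {b'} b≤N 1≤b' a<a' = begin-strict
    b + N * a   ≤⟨ ℕ.+-monoˡ-≤ (N * a) b≤N ⟩
    N + N * a   ≡⟨ ℕ.*-suc N a ⟨
    N * suc a   ≤⟨ ℕ.*-monoʳ-≤ N a<a' ⟩
    N * a'      <⟨ ℕ.m<n+m (N * a') 1≤b' ⟩
    b' + N * a' ∎
    where open ℕ.≤-Reasoning

  digit-unique : ∀ N {a a' b b'} → 1 ≤ b → b ≤ N → 1 ≤ b' → b' ≤ N → b + N * a ≡ b' + N * a' → a ≡ a'
  digit-unique N {a} {a'} 1≤b b≤N 1≤b' b'≤N eq with ℕ.<-cmp a a'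
  ... | tri≈ _ a≡a' _ = a≡a'
  ... | tri< a<a' _ _ = ⊥-elim (ℕ.<⇒≢ (digit-< N b≤N 1≤b' a<a') eq)
  ... | tri> _ _ a'<a = ⊥-elim (ℕ.<⇒≢ (digit-< N b'≤N 1≤b a'<a) (sym eq))

  map-mapMaybe-unique : ∀ {A B C : Set} (f : A → Maybe B) (g : B → C) {xs} → Unique xs →
    (∀ {x y u v} → f x ≡ just u → f y ≡ just v → g u ≡ g v → x ≡ y) → Unique (map g (mapMaybe f xs))
  map-mapMaybe-unique f g {[]}     []            inj = []
  map-mapMaybe-unique f g {x ∷ xs} (x∉xs ∷ uxs) inj with f x in fx
  ... | nothing = map-mapMaybe-unique f g uxs inj
  ... | just u  = fresh xs x∉xs ∷ map-mapMaybe-unique f g uxs inj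
    where
    fresh : ∀ ys → All (λ y → ¬ x ≡ y) ys → All (λ w → ¬ g u ≡ w) (map g (mapMaybe f ys))
    fresh []       []           = []
    fresh (y ∷ ys) (x≢y ∷ x∉ys) with f y in fy
    ... | nothing = fresh ys x∉ys
    ... | just v  = (λ gu≡gv → x≢y (inj fx fy gu≡gv)) ∷ fresh ys x∉ys

  map≡just : ∀ {A B : Set} {f : A → B} mx {y} → Maybe.map f mx ≡ just y → Σ A λ x → mx ≡ just x × f x ≡ y
  map≡just (just x) refl = x , refl , refl

  ∀Fin⇒∀≤ : ∀ {n} (P : ℕ → Set) → (∀ (t : Fin (suc n)) → P (toℕ t)) → ∀ t → t ≤ n → P t
  ∀Fin⇒∀≤ P P-fin t t≤n = subst P (Fin.toℕ-fromℕ< (s≤s t≤n)) (P-fin (Fin.fromℕ< (s≤s t≤n)))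

module Construction where

  open import Data.Bool using (Bool; true; false; not)
  open import Data.Bool.Properties using (not-involutive)
  open import Data.Fin as Fin using (Fin; zero; suc; toℕ)
  import Data.Fin.Properties as Fin
  open import Data.Integer using (ℤ; +_; 0ℤ; ∣_∣)
  open import Data.List using (List; []; _∷_; _++_; map; length; catMaybes; mapMaybe; concatMap; allFin)
  import Data.List.Properties as List
  open import Data.List.Relation.Unary.All using (All)
  import Data.List.Relation.Unary.All as All
  import Data.List.Relation.Unary.All.Properties as All
  open import Data.List.Relation.Unary.Unique.Propositional using (Unique)
  import Data.List.Relation.Unary.Unique.Propositional.Properties as Unique
  open import Data.Maybe as Maybe using (Maybe; just; nothing; maybe′)
  open import Data.Nat as ℕ using (ℕ; suc; _+_; _*_; _∸_; _≤_; _<_)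
  import Data.Nat.Properties as ℕ
  open import Data.Nat.Tactic.RingSolver using (solve-∀)
  open import Data.Product using (Σ; _×_; _,_; proj₁; proj₂)
  import Data.Product.Properties as Product
  open import Data.Unit using (tt)
  open import Data.Vec using (Vec; lookup) renaming ([] to []ᵛ; _∷_ to _∷ᵛ_)
  open import Function using (_∘_)
  open import Relation.Nullary using (Dec)
  open import Relation.Nullary.Decidable using (toWitness; _×-dec_; _→-dec_)
  open import Relation.Binary using (DecidableEquality)
  open import Relation.Binary.PropositionalEquality hiding (J)

  open import Defs
  open Lines
  open Lines.Stride 20
  open Indexing

  -- B δ is the 2 × 2 block placed on the δ-th cyclic diagonal; its diagonal entries carry the sign
  -- ε δ and the other two the opposite sign.
  table : Vec (Vec (Vec ℕ 2) 2) 5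
  table = ((9  ∷ᵛ 5  ∷ᵛ []ᵛ) ∷ᵛ (10 ∷ᵛ 15 ∷ᵛ []ᵛ) ∷ᵛ []ᵛ)
       ∷ᵛ ((17 ∷ᵛ 2  ∷ᵛ []ᵛ) ∷ᵛ (6  ∷ᵛ 3  ∷ᵛ []ᵛ) ∷ᵛ []ᵛ)
       ∷ᵛ ((16 ∷ᵛ 4  ∷ᵛ []ᵛ) ∷ᵛ (12 ∷ᵛ 19 ∷ᵛ []ᵛ) ∷ᵛ []ᵛ)
       ∷ᵛ ((18 ∷ᵛ 20 ∷ᵛ []ᵛ) ∷ᵛ (14 ∷ᵛ 1  ∷ᵛ []ᵛ) ∷ᵛ []ᵛ)
       ∷ᵛ ((7  ∷ᵛ 8  ∷ᵛ []ᵛ) ∷ᵛ (11 ∷ᵛ 13 ∷ᵛ []ᵛ) ∷ᵛ []ᵛ)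
       ∷ᵛ []ᵛ

  B : Fin 5 → Fin 2 → Fin 2 → ℕ
  B δ r c = lookup (lookup (lookup table δ) r) c

  ε : Fin 5 → Bool
  ε = lookup (true ∷ᵛ false ∷ᵛ true ∷ᵛ true ∷ᵛ false ∷ᵛ []ᵛ)

  σ : Fin 5 → Fin 2 → Fin 2 → Bool
  σ δ zero       zero       = ε δ
  σ δ zero       (suc zero) = not (ε δ)
  σ δ (suc zero) zero       = not (ε δ)
  σ δ (suc zero) (suc zero) = ε δ

  rowBlock : Fin 2 → Fin 5 → Block
  rowBlock r δ = block (σ δ r zero) (B δ r zero) (B δ r (suc zero))

  colBlock : Fin 2 → Fin 5 → Block
  colBlock c δ = block (σ δ zero c) (B δ zero c) (B δ (suc zero) c)

  LinePattern : List Block → Set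
  LinePattern Bs = length Bs ≡ 5 × Admissible Bs

  linePattern? : ∀ Bs → Dec (LinePattern Bs)
  linePattern? Bs = (length Bs ℕ.≟ 5) ×-dec admissible? Bs

  rows-admissible : ∀ r t → t ≤ 5 → LinePattern (map (rowBlock r) (cyclicUp 5 t))
  rows-admissible r = ∀Fin⇒∀≤ (λ t → LinePattern (map (rowBlock r) (cyclicUp 5 t))) (checked r)
    where
    checked : ∀ r (t : Fin 6) → LinePattern (map (rowBlock r) (cyclicUp 5 (toℕ t)))
    checked = toWitness {a? = Fin.all? λ r → Fin.all? λ t → linePattern? _} tt

  cols-admissible : ∀ c t → t ≤ 5 → LinePattern (map (colBlock c) (cyclicDown 5 t))
  cols-admissible c = ∀Fin⇒∀≤ (λ t → LinePattern (map (colBlock c) (cyclicDown 5 t))) (checked c)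
    where
    checked : ∀ c (t : Fin 6) → LinePattern (map (colBlock c) (cyclicDown 5 (toℕ t)))
    checked = toWitness {a? = Fin.all? λ c → Fin.all? λ t → linePattern? _} tt

  B-bounds : ∀ δ r c → 1 ≤ B δ r c × B δ r c ≤ 20
  B-bounds = toWitness {a? = Fin.all? λ δ → Fin.all? λ r → Fin.all? λ c →
                               (1 ℕ.≤? B δ r c) ×-dec (B δ r c ℕ.≤? 20)} tt

  B-injective : ∀ δ r c δ' r' c' → B δ r c ≡ B δ' r' c' → (δ , r , c) ≡ (δ' , r' , c')
  B-injective = toWitness {a? = Fin.all? λ δ → Fin.all? λ r → Fin.all? λ c →
                                Fin.all? λ δ' → Fin.all? λ r' → Fin.all? λ c' →
    (B δ r c ℕ.≟ B δ' r' c') →-dec ≡-dec₃ (δ , r , c) (δ' , r' , c')} tt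
    where
    ≡-dec₃ : DecidableEquality (Fin 5 × Fin 2 × Fin 2)
    ≡-dec₃ = Product.≡-dec Fin._≟_ (Product.≡-dec Fin._≟_ Fin._≟_)

  entry : Fin 5 → Fin 2 → Fin 2 → ℕ → ℤ
  entry δ r c I = signed (σ δ r c) (+ (B δ r c + 20 * I))

  cell : Fin 2 → Fin 2 → ℕ → ℕ → Maybe ℤ
  cell r c d I = Maybe.map (λ δ → entry δ r c I) (toFin? d)

  cellAt : ℕ → ℕ × Fin 2 → ℕ × Fin 2 → Maybe ℤ
  cellAt m (I , r) (J , c) = cell r c (offset m I J) I

  -- Index i = 2 I + r addresses line r of the I-th row (or column) of blocks.
  array : ∀ m → Array (2 * m)
  array m i j = cellAt m (halve (toℕ i)) (halve (toℕ j))

  rowPair : Fin 2 → ℕ → ℕ → List ℤ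
  rowPair r I d = catMaybes (cell r zero d I ∷ cell r (suc zero) d I ∷ [])

  colPair : Fin 2 → ℕ → ℕ → List ℤ
  colPair c I d = catMaybes (cell zero c d I ∷ cell (suc zero) c d I ∷ [])

  rowPair-blocks : ∀ r I d → rowPair r I d ≡ maybe′ (λ δ → blockEntries (rowBlock r δ , I)) [] (toFin? d)
  rowPair-blocks r I d with toFin? {5} d
  ... | nothing = refl
  ... | just δ  = cong (λ b → entry δ r zero I ∷ signed b (+ (B δ r (suc zero) + 20 * I)) ∷ []) (σ-flipʳ r)
    where
    σ-flipʳ : ∀ r → σ δ r (suc zero) ≡ not (σ δ r zero)
    σ-flipʳ zero       = refl
    σ-flipʳ (suc zero) = sym (not-involutive (ε δ))

  colPair-blocks : ∀ c (level : ℕ → ℕ) d →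
                   colPair c (level d) d ≡ maybe′ (λ δ → blockEntries (colBlock c δ , level (toℕ δ))) [] (toFin? d)
  colPair-blocks c level d with toFin? {5} d in eq
  ... | nothing = refl
  ... | just δ rewrite toFin?-just d eq =
    cong (λ b → entry δ zero c (level d) ∷ signed b (+ (B δ (suc zero) c + 20 * level d)) ∷ []) (σ-flipᶜ c)
    where
    σ-flipᶜ : ∀ c → σ δ (suc zero) c ≡ not (σ δ zero c)
    σ-flipᶜ zero       = refl
    σ-flipᶜ (suc zero) = sym (not-involutive (ε δ))

  row-array : ∀ m i → let (I , r) = halve (toℕ i) in
              row (array m) i ≡ concatMap (λ J → rowPair r I (offset m I J)) (range 0 m)
  row-array m i = begin
    mapMaybe (H ∘ toℕ) (allFin (2 * m))
      ≡⟨ mapMaybe-allFin (2 * m) H ⟩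
    mapMaybe H (range 0 (2 * m))
      ≡⟨ mapMaybe-pairs H 0 m ⟩
    concatMap (λ J → catMaybes (H (2 * J) ∷ H (suc (2 * J)) ∷ [])) (range 0 m)
      ≡⟨ List.concatMap-cong pair (range 0 m) ⟩
    concatMap (λ J → rowPair r I (offset m I J)) (range 0 m) ∎
    where
    open ≡-Reasoning
    I : ℕ
    I = proj₁ (halve (toℕ i))
    r : Fin 2
    r = proj₂ (halve (toℕ i))
    H : ℕ → Maybe ℤ
    H k = cellAt m (I , r) (halve k)
    pair : ∀ J → catMaybes (H (2 * J) ∷ H (suc (2 * J)) ∷ []) ≡ rowPair r I (offset m I J)
    pair J rewrite halve-2* J | halve-1+2* J = refl

  col-array : ∀ m j → let (J , c) = halve (toℕ j) in
              col (array m) j ≡ concatMap (λ I → colPair c I (offset m I J)) (range 0 m)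
  col-array m j = begin
    mapMaybe (H ∘ toℕ) (allFin (2 * m))
      ≡⟨ mapMaybe-allFin (2 * m) H ⟩
    mapMaybe H (range 0 (2 * m))
      ≡⟨ mapMaybe-pairs H 0 m ⟩
    concatMap (λ I → catMaybes (H (2 * I) ∷ H (suc (2 * I)) ∷ [])) (range 0 m)
      ≡⟨ List.concatMap-cong pair (range 0 m) ⟩
    concatMap (λ I → colPair c I (offset m I J)) (range 0 m) ∎
    where
    open ≡-Reasoning
    J : ℕ
    J = proj₁ (halve (toℕ j))
    c : Fin 2
    c = proj₂ (halve (toℕ j))
    H : ℕ → Maybe ℤ
    H k = cellAt m (halve k) (J , c)
    pair : ∀ I → catMaybes (H (2 * I) ∷ H (suc (2 * I)) ∷ []) ≡ colPair c I (offset m I J)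
    pair I rewrite halve-2* I | halve-1+2* I = refl

  row-line : ∀ r I u → 5 ≤ I + u →
             concatMap (λ J → rowPair r I (offset (I + u) I J)) (range 0 (I + u))
             ≡ expand (map (λ δ → rowBlock r δ , I) (cyclicUp 5 (u ℕ.⊓ 5)))
  row-line r I u 5≤m = begin
    concatMap (rowPair r I ∘ offset (I + u) I) (range 0 (I + u))
      ≡⟨ List.concatMap-cong (rowPair-blocks r I ∘ offset (I + u) I) (range 0 (I + u)) ⟩
    concatMap (maybe′ F [] ∘ toFin? ∘ offset (I + u) I) (range 0 (I + u))
      ≡⟨ concatMap-maybe F (toFin? ∘ offset (I + u) I) (range 0 (I + u)) ⟩
    concatMap F (mapMaybe (toFin? ∘ offset (I + u) I) (range 0 (I + u)))
      ≡⟨ cong (concatMap F) (List.mapMaybe-map toFin? (offset (I + u) I) (range 0 (I + u))) ⟨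
    concatMap F (mapMaybe toFin? (map (offset (I + u) I) (range 0 (I + u))))
      ≡⟨ cong (concatMap F ∘ mapMaybe toFin?) (row-offsets I u) ⟩
    concatMap F (mapMaybe toFin? (range u I ++ range 0 u))
      ≡⟨ cong (concatMap F) (row-window I u 5≤m) ⟩
    concatMap F (cyclicUp 5 (u ℕ.⊓ 5))
      ≡⟨ List.concatMap-map blockEntries (λ δ → rowBlock r δ , I) (cyclicUp 5 (u ℕ.⊓ 5)) ⟨
    expand (map (λ δ → rowBlock r δ , I) (cyclicUp 5 (u ℕ.⊓ 5))) ∎
    where
    open ≡-Reasoning
    F : Fin 5 → List ℤ
    F δ = blockEntries (rowBlock r δ , I)

  col-line : ∀ c J v → 5 ≤ suc J + v →
             concatMap (λ I → colPair c I (offset (suc J + v) I J)) (range 0 (suc J + v))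
             ≡ expand (map (λ δ → colBlock c δ , offset (suc J + v) (toℕ δ) J) (cyclicDown 5 (suc J ℕ.⊓ 5)))
  col-line c J v 5≤m = begin
    concatMap (λ I → colPair c I (offset m I J)) (range 0 m)
      ≡⟨ List.concatMap-map (λ (d , I) → colPair c I d) (λ I → offset m I J , I) (range 0 m) ⟨
    concatMap (λ (d , I) → colPair c I d) (map (λ I → offset m I J , I) (range 0 m))
      ≡⟨ cong (concatMap (λ (d , I) → colPair c I d)) (col-offsets J v) ⟩
    concatMap (λ (d , I) → colPair c I d) (map (λ d → d , level d) ds)
      ≡⟨ List.concatMap-map (λ (d , I) → colPair c I d) (λ d → d , level d) ds ⟩
    concatMap (λ d → colPair c (level d) d) ds
      ≡⟨ List.concatMap-cong (colPair-blocks c level) ds ⟩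
    concatMap (maybe′ F [] ∘ toFin?) ds
      ≡⟨ concatMap-maybe F toFin? ds ⟩
    concatMap F (mapMaybe toFin? ds)
      ≡⟨ cong (concatMap F) (col-window J v 5≤m) ⟩
    concatMap F (cyclicDown 5 (suc J ℕ.⊓ 5))
      ≡⟨ List.concatMap-map blockEntries (λ δ → colBlock c δ , level (toℕ δ)) (cyclicDown 5 (suc J ℕ.⊓ 5)) ⟨
    expand (map (λ δ → colBlock c δ , level (toℕ δ)) (cyclicDown 5 (suc J ℕ.⊓ 5))) ∎
    where
    open ≡-Reasoning
    m : ℕ
    m = suc J + v
    level : ℕ → ℕ
    level d = offset m d J
    ds : List ℕ
    ds = rangeDown 0 (suc J) ++ rangeDown (suc J) v
    F : Fin 5 → List ℤ
    F δ = blockEntries (colBlock c δ , level (toℕ δ))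

  linePattern-zeroSumSimple : ∀ {m} Bs → LinePattern (map proj₁ Bs) → All ((_< m) ∘ proj₂) Bs →
                              ZeroSumSimple 10 m (expand Bs)
  linePattern-zeroSumSimple {m} Bs (length≡5 , admissible) levels =
    subst (λ k → ZeroSumSimple k m (expand Bs)) (cong (2 *_) (trans (sym (List.length-map proj₁ Bs)) length≡5))
          (expand-zeroSumSimple Bs levels admissible)

  row-line-zeroSumSimple : ∀ r I u → 0 < u → 5 ≤ I + u →
    ZeroSumSimple 10 (I + u) (concatMap (λ J → rowPair r I (offset (I + u) I J)) (range 0 (I + u)))
  row-line-zeroSumSimple r I u 0<u 5≤m = subst (ZeroSumSimple 10 (I + u)) (sym (row-line r I u 5≤m))
    (linePattern-zeroSumSimple (map (λ δ → rowBlock r δ , I) order)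
      (subst LinePattern (List.map-∘ order) (rows-admissible r (u ℕ.⊓ 5) (ℕ.m⊓n≤n u 5)))
      (All.map⁺ (All.universal (λ _ → ℕ.m<m+n I 0<u) order)))
    where
    order : List (Fin 5)
    order = cyclicUp 5 (u ℕ.⊓ 5)

  row-zeroSumSimple : ∀ {m} → 5 ≤ m → ∀ i → ZeroSumSimple 10 m (row (array m) i)
  row-zeroSumSimple {m} 5≤m i = subst (ZeroSumSimple 10 m) (sym (row-array m i))
    (subst (λ m' → ZeroSumSimple 10 m' (concatMap (λ J → rowPair r I (offset m' I J)) (range 0 m'))) I+u≡m
      (row-line-zeroSumSimple r I (m ∸ I) (ℕ.m<n⇒0<n∸m I<m) (subst (5 ≤_) (sym I+u≡m) 5≤m)))
    where
    I : ℕ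
    I = proj₁ (halve (toℕ i))
    r : Fin 2
    r = proj₂ (halve (toℕ i))
    I<m : I < m
    I<m = halve-< (toℕ i) (Fin.toℕ<n i)
    I+u≡m : I + (m ∸ I) ≡ m
    I+u≡m = ℕ.m+[n∸m]≡n (ℕ.<⇒≤ I<m)

  col-line-zeroSumSimple : ∀ c J v → 5 ≤ suc J + v →
    ZeroSumSimple 10 (suc J + v) (concatMap (λ I → colPair c I (offset (suc J + v) I J)) (range 0 (suc J + v)))
  col-line-zeroSumSimple c J v 5≤m = subst (ZeroSumSimple 10 m) (sym (col-line c J v 5≤m))
    (linePattern-zeroSumSimple (map (λ δ → colBlock c δ , offset m (toℕ δ) J) order)
      (subst LinePattern (List.map-∘ order) (cols-admissible c (suc J ℕ.⊓ 5) (ℕ.m⊓n≤n (suc J) 5)))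
      (All.map⁺ (All.universal (λ δ → offset-< m (toℕ δ) J (ℕ.m≤m+n (suc J) v)) order)))
    where
    m : ℕ
    m = suc J + v
    order : List (Fin 5)
    order = cyclicDown 5 (suc J ℕ.⊓ 5)

  col-zeroSumSimple : ∀ {m} → 5 ≤ m → ∀ j → ZeroSumSimple 10 m (col (array m) j)
  col-zeroSumSimple {m} 5≤m j = subst (ZeroSumSimple 10 m) (sym (col-array m j))
    (subst (λ m' → ZeroSumSimple 10 m' (concatMap (λ I → colPair c I (offset m' I J)) (range 0 m'))) J+v≡m
      (col-line-zeroSumSimple c J (m ∸ suc J) (subst (5 ≤_) (sym J+v≡m) 5≤m)))
    where
    J : ℕ
    J = proj₁ (halve (toℕ j))
    c : Fin 2
    c = proj₂ (halve (toℕ j))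
    J+v≡m : suc J + (m ∸ suc J) ≡ m
    J+v≡m = ℕ.m+[n∸m]≡n (halve-< (toℕ j) (Fin.toℕ<n j))

  cellAt-just : ∀ m (h h' : ℕ × Fin 2) {x} → cellAt m h h' ≡ just x →
                Σ (Fin 5) λ δ → toℕ δ ≡ offset m (proj₁ h) (proj₁ h')
                              × ∣ x ∣ ≡ B δ (proj₂ h) (proj₂ h') + 20 * proj₁ h
  cellAt-just m (I , r) (J , c) eq with map≡just {f = λ δ → entry δ r c I} (toFin? (offset m I J)) eq
  ... | δ , toFin≡δ , refl = δ , toFin?-just (offset m I J) toFin≡δ , ∣signed∣ (σ δ r c) (B δ r c + 20 * I)

  entry-range : ∀ m i j x → array m i j ≡ just x → (x ≢ 0ℤ) × (∣ x ∣ ≤ 2 * m * 10)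
  entry-range m i j x eq with cellAt-just m (halve (toℕ i)) (halve (toℕ j)) eq
  ... | δ , _ , ∣x∣≡ = x≢0 , ∣x∣≤20m
    where
    I : ℕ
    I = proj₁ (halve (toℕ i))
    bounds : 1 ≤ B δ _ _ × B δ _ _ ≤ 20
    bounds = B-bounds δ (proj₂ (halve (toℕ i))) (proj₂ (halve (toℕ j)))
    x≢0 : x ≢ 0ℤ
    x≢0 refl = ℕ.<⇒≢ (ℕ.≤-trans (proj₁ bounds) (ℕ.m≤m+n _ (20 * I))) ∣x∣≡
    ∣x∣≤20m : ∣ x ∣ ≤ 2 * m * 10
    ∣x∣≤20m = begin
      ∣ x ∣            ≡⟨ ∣x∣≡ ⟩
      B δ _ _ + 20 * I ≤⟨ ℕ.+-monoˡ-≤ (20 * I) (proj₂ bounds) ⟩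
      20 + 20 * I      ≡⟨ ℕ.*-suc 20 I ⟨
      20 * suc I       ≤⟨ ℕ.*-monoʳ-≤ 20 (halve-< {m} (toℕ i) (Fin.toℕ<n i)) ⟩
      20 * m           ≡⟨ regroup m ⟩
      2 * m * 10       ∎
      where
      open ℕ.≤-Reasoning
      regroup : ∀ m → 20 * m ≡ 2 * m * 10
      regroup = solve-∀

  array-injective : ∀ m (p q : Fin (2 * m) × Fin (2 * m)) {u v} →
                    array m (proj₁ p) (proj₂ p) ≡ just u → array m (proj₁ q) (proj₂ q) ≡ just v →
                    ∣ u ∣ ≡ ∣ v ∣ → p ≡ q
  array-injective m (i , j) (i' , j') eu ev ∣u∣≡∣v∣
    with cellAt-just m (halve (toℕ i)) (halve (toℕ j)) eu | cellAt-just m (halve (toℕ i')) (halve (toℕ j')) ev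
  ... | δ , δ≡ , ∣u∣≡ | δ' , δ'≡ , ∣v∣≡ = cong₂ _,_ i≡i' j≡j'
    where
    I J I' J' : ℕ
    I = proj₁ (halve (toℕ i))
    J = proj₁ (halve (toℕ j))
    I' = proj₁ (halve (toℕ i'))
    J' = proj₁ (halve (toℕ j'))
    r c r' c' : Fin 2
    r = proj₂ (halve (toℕ i))
    c = proj₂ (halve (toℕ j))
    r' = proj₂ (halve (toℕ i'))
    c' = proj₂ (halve (toℕ j'))
    sum≡ : B δ r c + 20 * I ≡ B δ' r' c' + 20 * I'
    sum≡ = trans (sym ∣u∣≡) (trans ∣u∣≡∣v∣ ∣v∣≡)
    I≡I' : I ≡ I'
    I≡I' = digit-unique 20 (proj₁ (B-bounds δ r c)) (proj₂ (B-bounds δ r c))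
                           (proj₁ (B-bounds δ' r' c')) (proj₂ (B-bounds δ' r' c')) sum≡
    same : (δ , r , c) ≡ (δ' , r' , c')
    same = B-injective δ r c δ' r' c'
      (ℕ.+-cancelʳ-≡ (20 * I) _ _ (trans sum≡ (cong (λ k → B δ' r' c' + 20 * k) (sym I≡I'))))
    i≡i' : i ≡ i'
    i≡i' = Fin.toℕ-injective (halve-injective (toℕ i) (toℕ i') (cong₂ _,_ I≡I' (cong (proj₁ ∘ proj₂) same)))
    offsets≡ : offset m I J ≡ offset m I J'
    offsets≡ = trans (sym δ≡)
      (trans (cong (toℕ ∘ proj₁) same) (trans δ'≡ (cong (λ k → offset m k J') (sym I≡I'))))
    J≡J' : J ≡ J'
    J≡J' = offset-injective m I J J' (halve-< (toℕ i) (Fin.toℕ<n i))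
                                     (halve-< (toℕ j) (Fin.toℕ<n j)) (halve-< (toℕ j') (Fin.toℕ<n j')) offsets≡
    j≡j' : j ≡ j'
    j≡j' = Fin.toℕ-injective (halve-injective (toℕ j) (toℕ j') (cong₂ _,_ J≡J' (cong (proj₂ ∘ proj₂) same)))

  abs-distinct : ∀ m → Unique (map ∣_∣ (entries (array m)))
  abs-distinct m = map-mapMaybe-unique (λ p → array m (proj₁ p) (proj₂ p)) ∣_∣
    (Unique.cartesianProduct⁺ (Unique.allFin⁺ (2 * m)) (Unique.allFin⁺ (2 * m)))
    (λ {p} {q} → array-injective m p q)

  2Nm<2nk+1 : ∀ m → 2 * 20 * m < suc (2 * (2 * m) * 10)
  2Nm<2nk+1 m = ℕ.s≤s (ℕ.≤-reflexive (regroup m))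
    where
    regroup : ∀ m → 2 * 20 * m ≡ 2 * (2 * m) * 10
    regroup = solve-∀

open import Defs
open import Data.Nat using (ℕ; _≤_; _*_)
import Data.Nat.Properties as ℕ
open import Data.Product using (Σ; _,_)
open import Function using (_∘_)
open import Relation.Binary.PropositionalEquality using (_≡_; refl)
open Construction
open Lines.Stride 20 using (ZeroSumSimple; module ZeroSumSimple)

proposition4p11 : (n : ℕ) → 10 ≤ n → (Σ ℕ λ m → n ≡ 2 * m) →
    Σ (Array n) (IsSHStar n 10)
proposition4p11 .(2 * m) 10≤n (m , refl) = array m , record
  { isH = record
    { entry-range  = entry-range m
    ; abs-distinct = abs-distinct m
    ; row-size     = ZeroSumSimple.length≡ ∘ rows
    ; col-size     = ZeroSumSimple.length≡ ∘ cols
    ; row-sum      = ZeroSumSimple.sum≡0 ∘ rows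
    ; col-sum      = ZeroSumSimple.sum≡0 ∘ cols
    }
  ; row-simple₁ = λ i → ZeroSumSimple.simple (rows i) _ (2Nm<2nk+1 m)
  ; row-simple₂ = λ i → ZeroSumSimple.simple (rows i) _ (ℕ.m≤n⇒m≤1+n (2Nm<2nk+1 m))
  ; col-simple₁ = λ j → ZeroSumSimple.simple (cols j) _ (2Nm<2nk+1 m)
  ; col-simple₂ = λ j → ZeroSumSimple.simple (cols j) _ (ℕ.m≤n⇒m≤1+n (2Nm<2nk+1 m))
  }
  where
  rows : ∀ i → ZeroSumSimple 10 m (row (array m) i)
  rows = row-zeroSumSimple (ℕ.*-cancelˡ-≤ 2 10≤n)
  cols : ∀ j → ZeroSumSimple 10 m (col (array m) j)
  cols = col-zeroSumSimple (ℕ.*-cancelˡ-≤ 2 10≤n)
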